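{- Let $(T_n)_{n\ge1}$ be the uniform attachment sequence of plane trees described in the context. Then for all integers $m\ge1$ and all $\varepsilon\in(0,1)$, $\limsup_{n\to\infty}\mathbb{P}\big(\exists u\in\mathbb{U}:\mathrm{w}(u)\ge m,\ |\theta_uT_n|\ge\varepsilon n\big)\le\varepsilon^{ -2}(2/3)^{m-1}$.
   Context: $\mathbb{U}$ is the set of finite words over $\{1,2,\dots\}$ with empty word $\varnothing$; $u*v$ concatenation. The weight of $u=(u_1,\dots,u_n)$ is $\mathrm{w}(u)=\sum_{i=1}^nu_i$. For finite $t\subset\mathbb{U}$, $\theta_ut=\{v:u*v\in t\}$ (empty if $u\notin t$), and $k_u(t)$ is the number of $j\ge1$ with $u*j\in t$. Model: $T_1=\{\varnothing\}$, $T_{n+1}=T_n\cup\{V_n*(k_{V_n}(T_n)+1)\}$ with $V_n$ uniform on $T_n$ given the past.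
   Formalization: The parameter ε ranges over the rationals in (0,1) rather than over all reals in (0,1). -}

module Defs where

open import Data.Bool using (Bool; true; false; if_then_else_; not; _∧_; _∨_)
open import Data.Nat as ℕ using (ℕ; zero; suc; _!; _≡ᵇ_)
open import Data.Nat.Properties using (_!≢0)
open import Data.List as List using (List; []; _∷_; _++_; [_]; length; filterᵇ; map; drop)
open import Data.Nat.ListAction using (sum)
open import Data.Bool.ListAction using (any)
open import Data.Vec as Vec using (Vec; lookup; toList; _∷ʳ_)
open import Data.Fin using (Fin)
open import Data.Product using (Σ; _×_)
open import Data.Integer using (+_)
open import Data.Rational as ℚ using (ℚ; _/_; 1/_; _*_; Positive)
open import Data.Rational.Properties using (pos⇒nonZero)
open import Relation.Nullary.Decidable using (⌊_⌋)
open import Relation.Unary using (Decidable)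

-- Words of U (finite words over {1,2,...}); entries are naturals, the
-- model below only ever creates positive entries.

Word : Set
Word = List ℕ

weight : Word → ℕ
weight = sum

eqW : Word → Word → Bool
eqW []       []       = true
eqW (a ∷ u)  (b ∷ v)  = (a ≡ᵇ b) ∧ eqW u v
eqW _        _        = false

isPrefix : Word → Word → Bool
isPrefix []      _       = true
isPrefix (a ∷ u) []      = false
isPrefix (a ∷ u) (b ∷ v) = (a ≡ᵇ b) ∧ isPrefix u v

isChildOf : Word → Word → Bool
isChildOf []      (j ∷ []) = not (j ≡ᵇ 0)
isChildOf []      _        = false
isChildOf (a ∷ u) []       = false
isChildOf (a ∷ u) (b ∷ v)  = (a ≡ᵇ b) ∧ isChildOf u v

-- finite trees, given as the list of their vertices
Tree : Set
Tree = List Word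

memb : Word → Tree → Bool
memb u t = any (eqW u) t

k : Word → Tree → ℕ
k u t = length (filterᵇ (isChildOf u) t)

θ : Word → Tree → Tree
θ u t = if memb u t
        then map (drop (length u)) (filterᵇ (isPrefix u) t)
        else []

-- A history of length n records the choices V_1,...,V_{n-1}:
-- V_j is the c_j-th vertex (in insertion order) of T_j, c_j ∈ Fin j.
-- Each of the (n-1)! histories has probability 1/(n-1)!, which makes
-- V_j uniform on T_j given the past.

data Hist : ℕ → Set where
  start : Hist 1
  step  : ∀ {n} → Hist n → Fin n → Hist (suc n)

tree : ∀ {n} → Hist n → Vec Word n
tree start      = [] Vec.∷ Vec.[]
tree (step h c) =
  let t = tree h
      v = lookup t c
  in t ∷ʳ (v ++ [ suc (k v (toList t)) ])

T : ∀ {n} → Hist n → Tree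
T h = toList (tree h)

Event : (m : ℕ) (ε : ℚ) {n : ℕ} → Hist n → Set
Event m ε {n} h =
  Σ Word λ u → (m ℕ.≤ weight u) × (ε * (+ n / 1) ℚ.≤ (+ length (θ u (T h)) / 1))

_/!_ : ℕ → ℕ → ℚ
a /! n = (+ a / (n !)) {{n !≢0}}

powℚ : ℚ → ℕ → ℚ
powℚ q zero    = ℚ.1ℚ
powℚ q (suc n) = q * powℚ q n

bound : (m : ℕ) (ε : ℚ) → .{{Positive ε}} → ℚ
bound m ε = ((1/ (ε * ε)) {{pos⇒nonZero (ε * ε) {{posε²}}}}) * powℚ (+ 2 / 3) (m ℕ.∸ 1)
  where
  open import Data.Rational.Properties using (pos*pos⇒pos)
  posε² : Positive (ε * ε)
  posε² = pos*pos⇒pos ε ε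

{-# OPTIONS --safe #-}
module Submission where

-- Write a_t(v) = w(v) + k_v(t) + 1 for the weight of the next child of v in t (nextChildWeight),
-- G_j(t) for the number of vertices v with a_t(v) ≥ j (heavySlots), and Q_m(t) for the number of ordered
-- pairs of vertices whose longest common prefix has weight ≥ m (heavyPairs).  The vertices of θ_u t all
-- carry the prefix u, so w(u) ≥ m gives |θ_u t|² ≤ Q_m(t), and by Markov's inequality it suffices to show
-- E Q_m(T_n) ≤ (2/3)^(m-1) n².
--
-- Attaching a child to V raises a(V) by one and creates a vertex with the same raised value, so summing
-- over the n choices of V in a tree t with n vertices gives the exact recursions
--   Σ_V G_(j+1)(t_V) + G_(j+1)(t) = n G_(j+1)(t) + 2 G_j(t),    Σ_V Q_m(t_V) = (n + 2) Q_m(t) + G_m(t).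
-- With A_0 = n and A_(j+1) = 3^j G_(j+1) + 2 A_j (slotPotential) they make Φ_j = 3^(j+1) Q_(j+1) + A_(j+1)
-- (potential) an eigenfunction: Σ_V Φ_j(t_V) = (n + 2) Φ_j(t).  Hence Φ_j(T_n) sums to 3·2^j (n+1)!/2
-- over the (n-1)! histories, and E Q_(j+1)(T_n) ≤ (2/3)^j n(n+1)/2.  This holds for every n, so no limit
-- is needed: N = 0 works.

open import Defs
open import Data.List using (List; []; _∷_; _++_; [_]; length)
open import Data.List.Membership.Propositional using (_∈_)
open import Data.List.Relation.Unary.Any as Any using (here; there)
open import Data.List.Relation.Unary.All as All using (All; []; _∷_)
open import Data.List.Relation.Unary.AllPairs using ([]; _∷_)
open import Data.List.Relation.Unary.Unique.Propositional using (Unique)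
open import Data.Product using (∃; _×_; _,_; proj₁; proj₂)
open import Data.Sum using (_⊎_; inj₁; inj₂)
open import Data.Empty using (⊥-elim)
open import Function using (_∘_)
open import Relation.Binary.PropositionalEquality
  using (_≡_; _≢_; refl; sym; trans; cong; cong₂; subst; subst₂; module ≡-Reasoning)

module ListSums where

  open import Data.Nat using (ℕ; zero; suc; _+_; _*_; _≤_; z≤n; s≤s)
  open import Data.Nat.Properties
    using (module ≤-Reasoning; +-assoc; +-identityʳ; *-distribˡ-+; *-zeroʳ; +-mono-≤; +-monoʳ-≤; +-commutativeSemigroup)
  open import Algebra.Properties.CommutativeSemigroup +-commutativeSemigroup using (interchange; xy∙z≈zy∙x; x∙yz≈y∙xz)
  open import Data.Nat.Tactic.RingSolver using (solve-∀)
  open import Data.Nat.ListAction using (sum)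
  open import Data.Nat.ListAction.Properties using (sum-++)
  open import Data.List using (map; concatMap)
  open import Data.List.Properties using (map-++)
  open import Data.List.Membership.Propositional.Properties using (∈-∃++; ∈-++⁻; ∈-++⁺ˡ; ∈-++⁺ʳ)
  open import Data.List.Relation.Binary.Subset.Propositional using (_⊆_)

  ∑ : {A : Set} → List A → (A → ℕ) → ℕ
  ∑ xs f = sum (map f xs)

  syntax ∑ xs (λ x → e) = ∑[ x ← xs ] e

  module _ {A : Set} where

    ∑-++ : ∀ (xs ys : List A) f → ∑ (xs ++ ys) f ≡ ∑ xs f + ∑ ys f
    ∑-++ xs ys f = trans (cong sum (map-++ f xs ys)) (sum-++ (map f xs) (map f ys))

    ∑-∷ʳ : ∀ (xs : List A) x f → ∑ (xs ++ [ x ]) f ≡ ∑ xs f + f x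
    ∑-∷ʳ xs x f = trans (∑-++ xs [ x ] f) (cong (∑ xs f +_) (+-identityʳ (f x)))

    ∑-cong : ∀ (xs : List A) {f g} → (∀ {x} → x ∈ xs → f x ≡ g x) → ∑ xs f ≡ ∑ xs g
    ∑-cong []       f≡g = refl
    ∑-cong (x ∷ xs) f≡g = cong₂ _+_ (f≡g (here refl)) (∑-cong xs (f≡g ∘ there))

    ∑-mono : ∀ (xs : List A) {f g} → (∀ {x} → x ∈ xs → f x ≤ g x) → ∑ xs f ≤ ∑ xs g
    ∑-mono []       f≤g = z≤n
    ∑-mono (x ∷ xs) f≤g = +-mono-≤ (f≤g (here refl)) (∑-mono xs (f≤g ∘ there))

    ∑-+ : ∀ (xs : List A) f g → ∑[ x ← xs ] (f x + g x) ≡ ∑ xs f + ∑ xs g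
    ∑-+ []       f g = refl
    ∑-+ (x ∷ xs) f g = trans (cong (f x + g x +_) (∑-+ xs f g)) (interchange (f x) (g x) (∑ xs f) (∑ xs g))

    ∑-*ˡ : ∀ (xs : List A) c f → ∑[ x ← xs ] (c * f x) ≡ c * ∑ xs f
    ∑-*ˡ []       c f = sym (*-zeroʳ c)
    ∑-*ˡ (x ∷ xs) c f = trans (cong (c * f x +_) (∑-*ˡ xs c f)) (sym (*-distribˡ-+ c (f x) _))

    ∑-const : ∀ (xs : List A) c → ∑[ x ← xs ] c ≡ length xs * c
    ∑-const []       c = refl
    ∑-const (x ∷ xs) c = cong (c +_) (∑-const xs c)

    ∑-concatMap : ∀ {B : Set} (g : B → List A) ys f → ∑ (concatMap g ys) f ≡ ∑[ y ← ys ] ∑ (g y) f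
    ∑-concatMap g []       f = refl
    ∑-concatMap g (y ∷ ys) f = trans (∑-++ (g y) _ f) (cong (∑ (g y) f +_) (∑-concatMap g ys f))

    ∑-update : ∀ {xs : List A} {y} f g → Unique xs → y ∈ xs → (∀ {x} → x ∈ xs → x ≢ y → f x ≡ g x) →
               ∑ xs f + g y ≡ ∑ xs g + f y
    ∑-update {x ∷ xs} f g (x∉xs ∷ _) (here refl) f≡g = begin
      f x + ∑ xs f + g x ≡⟨ cong (λ s → f x + s + g x) (∑-cong xs off-x) ⟩
      f x + ∑ xs g + g x ≡⟨ xy∙z≈zy∙x (f x) (∑ xs g) (g x) ⟩
      g x + ∑ xs g + f x ∎
      where
      open ≡-Reasoning
      off-x : ∀ {z} → z ∈ xs → f z ≡ g z
      off-x z∈ = f≡g (there z∈) (All.lookup x∉xs z∈ ∘ sym)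
    ∑-update {x ∷ xs} {y} f g (x∉xs ∷ u) (there y∈) f≡g = begin
      f x + ∑ xs f + g y   ≡⟨ +-assoc (f x) _ _ ⟩
      f x + (∑ xs f + g y) ≡⟨ cong₂ _+_ (f≡g (here refl) (All.lookup x∉xs y∈)) (∑-update f g u y∈ (f≡g ∘ there)) ⟩
      g x + (∑ xs g + f y) ≡⟨ +-assoc (g x) _ _ ⟨
      g x + ∑ xs g + f y   ∎
      where open ≡-Reasoning

    ∑-mono-⊆ : ∀ {xs ys : List A} f → Unique xs → xs ⊆ ys → ∑ xs f ≤ ∑ ys f
    ∑-mono-⊆ {[]}     f _          _     = z≤n
    ∑-mono-⊆ {x ∷ xs} f (x∉xs ∷ u) xs⊆ys with ∈-∃++ (xs⊆ys (here refl))
    ... | as , bs , refl = begin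
      f x + ∑ xs f             ≤⟨ +-monoʳ-≤ (f x) (∑-mono-⊆ f u xs⊆as++bs) ⟩
      f x + ∑ (as ++ bs) f     ≡⟨ cong (f x +_) (∑-++ as bs f) ⟩
      f x + (∑ as f + ∑ bs f)  ≡⟨ x∙yz≈y∙xz (f x) (∑ as f) (∑ bs f) ⟩
      ∑ as f + (f x + ∑ bs f)  ≡⟨ ∑-++ as (x ∷ bs) f ⟨
      ∑ (as ++ x ∷ bs) f       ∎
      where
      open ≤-Reasoning
      xs⊆as++bs : xs ⊆ as ++ bs
      xs⊆as++bs z∈xs with ∈-++⁻ as (xs⊆ys (there z∈xs))
      ... | inj₁ z∈as         = ∈-++⁺ˡ z∈as
      ... | inj₂ (here refl)  = ⊥-elim (All.lookup x∉xs z∈xs refl)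
      ... | inj₂ (there z∈bs) = ∈-++⁺ʳ as z∈bs

    ∑∑-∷ʳ : ∀ (xs : List A) x (F : A → A → ℕ) → (∀ u v → F u v ≡ F v u) →
            ∑[ u ← xs ++ [ x ] ] ∑[ v ← xs ++ [ x ] ] F u v
              ≡ ∑[ u ← xs ] ∑[ v ← xs ] F u v + 2 * ∑[ v ← xs ] F x v + F x x
    ∑∑-∷ʳ xs x F F-sym = begin
      ∑[ u ← xs ++ [ x ] ] ∑[ v ← xs ++ [ x ] ] F u v
        ≡⟨ ∑-∷ʳ xs x _ ⟩
      ∑[ u ← xs ] ∑[ v ← xs ++ [ x ] ] F u v + ∑[ v ← xs ++ [ x ] ] F x v
        ≡⟨ cong₂ _+_ (∑-cong xs (λ {u} _ → ∑-∷ʳ xs x (F u))) (∑-∷ʳ xs x (F x)) ⟩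
      ∑[ u ← xs ] (∑[ v ← xs ] F u v + F u x) + (R + F x x)
        ≡⟨ cong (_+ (R + F x x)) (∑-+ xs _ _) ⟩
      S + ∑[ u ← xs ] F u x + (R + F x x)
        ≡⟨ cong (λ r → S + r + (R + F x x)) (∑-cong xs (λ {u} _ → F-sym u x)) ⟩
      S + R + (R + F x x)
        ≡⟨ regroup S R (F x x) ⟩
      S + 2 * R + F x x ∎
      where
      open ≡-Reasoning
      S = ∑[ u ← xs ] ∑[ v ← xs ] F u v
      R = ∑[ v ← xs ] F x v
      regroup : ∀ a b c → a + b + (b + c) ≡ a + 2 * b + c
      regroup = solve-∀

  𝟙[_≤_] : ℕ → ℕ → ℕ
  𝟙[ zero  ≤ n     ] = 1
  𝟙[ suc m ≤ zero  ] = 0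
  𝟙[ suc m ≤ suc n ] = 𝟙[ m ≤ n ]

  𝟙[≤]-true : ∀ {m n} → m ≤ n → 𝟙[ m ≤ n ] ≡ 1
  𝟙[≤]-true {zero}  _         = refl
  𝟙[≤]-true {suc m} (s≤s m≤n) = 𝟙[≤]-true m≤n

module PlaneTrees where

  open ListSums
  open import Data.Bool as Bool using (true; false)
  open import Data.Bool.Properties using (T-∧)
  open import Data.Nat using (ℕ; zero; suc; _+_; _*_; _^_; _≤_; _!; _≟_; z≤n; s≤s)
  open import Data.Nat.Properties
    using (module ≤-Reasoning; ≡⇒≡ᵇ; ≡ᵇ⇒≡; <-irrefl; ≤-trans; ≤-reflexive; m≤m+n; m≤n+m;
           +-comm; +-assoc; +-suc; +-identityʳ; +-cancelʳ-≡; *-identityʳ; *-zeroʳ; *-assoc; *-distribʳ-+;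
           *-cancelˡ-≤; *-mono-≤; *-monoˡ-≤; *-monoʳ-≤; +-commutativeSemigroup; *-commutativeSemigroup)
  open import Algebra.Properties.CommutativeSemigroup +-commutativeSemigroup using (xy∙z≈xz∙y)
  open import Algebra.Properties.CommutativeSemigroup *-commutativeSemigroup using (x∙yz≈y∙xz)
  open import Data.Nat.Tactic.RingSolver using (solve-∀)
  open import Data.Nat.ListAction using (sum)
  open import Data.Nat.ListAction.Properties using (sum-++)
  open import Data.List using (filterᵇ; drop; map; tabulate; concatMap)
  open import Data.List.Properties
    using (∷-injective; ∷ʳ-injectiveˡ; ++-assoc; ++-conicalʳ; length-++; length-map; map-tabulate; tabulate-cong;
           filter-++; filter-accept; filter-reject; filter-none)
  open import Data.List.Membership.Propositional.Properties using (∈-++⁻; ∈-concatMap⁺; ∈-tabulate⁺; ∈-filter⁻)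
  import Data.List.Relation.Unary.Unique.Propositional.Properties as Unique
  open import Data.Vec as Vec using (Vec; lookup; toList)
  open import Data.Vec.Properties using (toList-∷ʳ; length-toList)
  open import Data.Vec.Membership.Propositional.Properties using (∈-lookup; ∈-toList⁺)
  open import Function using (Equivalence)
  open import Relation.Nullary using (¬_; yes; no; contradiction)
  open import Relation.Nullary.Decidable using (T?)

  open Equivalence using (to; from)

  -- Words

  isPrefix-sound : ∀ u v → Bool.T (isPrefix u v) → ∃ λ w → v ≡ u ++ w
  isPrefix-sound []      v       _ = v , refl
  isPrefix-sound (a ∷ u) (b ∷ v) p with to T-∧ p
  ... | a≡ᵇb , p′ with ≡ᵇ⇒≡ a b a≡ᵇb | isPrefix-sound u v p′
  ...   | refl | w , refl = w , refl

  isChildOf-sound : ∀ u v → Bool.T (isChildOf u v) → ∃ λ j → v ≡ u ++ [ j ]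
  isChildOf-sound []      (j ∷ []) _ = j , refl
  isChildOf-sound (a ∷ u) (b ∷ v)  p with to T-∧ p
  ... | a≡ᵇb , p′ with ≡ᵇ⇒≡ a b a≡ᵇb | isChildOf-sound u v p′
  ...   | refl | j , refl = j , refl

  isChildOf-∷ʳ : ∀ u j → Bool.T (isChildOf u (u ++ [ suc j ]))
  isChildOf-∷ʳ []      j = _
  isChildOf-∷ʳ (a ∷ u) j = from T-∧ (≡⇒≡ᵇ a a refl , isChildOf-∷ʳ u j)

  isChildOf-irrefl : ∀ u → ¬ Bool.T (isChildOf u u)
  isChildOf-irrefl (a ∷ u) p = isChildOf-irrefl u (proj₂ (to T-∧ p))

  weight-++-≤ˡ : ∀ u w → weight u ≤ weight (u ++ w)
  weight-++-≤ˡ u w = ≤-trans (m≤m+n (weight u) (weight w)) (≤-reflexive (sym (sum-++ u w)))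

  decompose-∷ʳ : ∀ {A : Set} (u : List A) j w V s → u ++ j ∷ w ≡ V ++ [ s ] →
                 (u ≡ V × j ≡ s × w ≡ []) ⊎ ∃ λ w′ → V ≡ u ++ j ∷ w′
  decompose-∷ʳ []          j w []      s refl = inj₁ (refl , refl , refl)
  decompose-∷ʳ []          j w (b ∷ V) s refl = inj₂ (V , refl)
  decompose-∷ʳ (_ ∷ [])    j w []      s ()
  decompose-∷ʳ (_ ∷ _ ∷ _) j w []      s ()
  decompose-∷ʳ (a ∷ u)     j w (b ∷ V) s eq with ∷-injective eq
  ... | refl , eq′ with decompose-∷ʳ u j w V s eq′
  ...   | inj₁ (refl , refl , refl) = inj₁ (refl , refl , refl)
  ...   | inj₂ (w′ , refl)          = inj₂ (w′ , refl)

  lcp : Word → Word → Word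
  lcp (a ∷ u) (b ∷ v) with a ≟ b
  ... | yes _ = a ∷ lcp u v
  ... | no  _ = []
  lcp _ _ = []

  lcp-comm : ∀ u v → lcp u v ≡ lcp v u
  lcp-comm []      []      = refl
  lcp-comm []      (b ∷ v) = refl
  lcp-comm (a ∷ u) []      = refl
  lcp-comm (a ∷ u) (b ∷ v) with a ≟ b | b ≟ a
  ... | yes refl | yes _    = cong (a ∷_) (lcp-comm u v)
  ... | yes refl | no  a≢a  = ⊥-elim (a≢a refl)
  ... | no  a≢b  | yes refl = ⊥-elim (a≢b refl)
  ... | no  _    | no  _    = refl

  lcp-++ : ∀ u v w → lcp (u ++ v) (u ++ w) ≡ u ++ lcp v w
  lcp-++ []      v w = refl
  lcp-++ (a ∷ u) v w with a ≟ a
  ... | yes _   = cong (a ∷_) (lcp-++ u v w)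
  ... | no  a≢a = ⊥-elim (a≢a refl)

  lcp-self : ∀ u → lcp u u ≡ u
  lcp-self []      = refl
  lcp-self (a ∷ u) with a ≟ a
  ... | yes _   = cong (a ∷_) (lcp-self u)
  ... | no  a≢a = ⊥-elim (a≢a refl)

  lcp-∷ʳ : ∀ V s v → (∀ w → v ≢ V ++ s ∷ w) → lcp (V ++ [ s ]) v ≡ lcp V v
  lcp-∷ʳ []      s []      _ = refl
  lcp-∷ʳ []      s (a ∷ v) v≢ with s ≟ a
  ... | yes refl = ⊥-elim (v≢ v refl)
  ... | no  _    = refl
  lcp-∷ʳ (b ∷ V) s []      _ = refl
  lcp-∷ʳ (b ∷ V) s (a ∷ v) v≢ with b ≟ a
  ... | yes refl = cong (b ∷_) (lcp-∷ʳ V s v (λ w → v≢ w ∘ cong (b ∷_)))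
  ... | no  _    = refl

  -- One attachment step

  k-++ : ∀ u t t′ → k u (t ++ t′) ≡ k u t + k u t′
  k-++ u t t′ = trans (cong length (filter-++ (T? ∘ isChildOf u) t t′)) (length-++ (filterᵇ (isChildOf u) t))

  newVertex : Tree → Word → Word
  newVertex t V = V ++ [ suc (k V t) ]

  attach : Tree → Word → Tree
  attach t V = t ++ [ newVertex t V ]

  k-attach-self : ∀ t V → k V (attach t V) ≡ suc (k V t)
  k-attach-self t V = begin
    k V (attach t V)              ≡⟨ k-++ V t _ ⟩
    k V t + k V [ newVertex t V ] ≡⟨ cong (λ c → k V t + length c) (filter-accept (T? ∘ isChildOf V) (isChildOf-∷ʳ V (k V t))) ⟩
    k V t + 1                     ≡⟨ +-comm (k V t) 1 ⟩
    suc (k V t)                   ∎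
    where open ≡-Reasoning

  k-attach-other : ∀ t {u V} → u ≢ V → k u (attach t V) ≡ k u t
  k-attach-other t {u} {V} u≢V = begin
    k u (attach t V)              ≡⟨ k-++ u t _ ⟩
    k u t + k u [ newVertex t V ] ≡⟨ cong (λ c → k u t + length c) (filter-reject (T? ∘ isChildOf u) not-child) ⟩
    k u t + 0                     ≡⟨ +-identityʳ (k u t) ⟩
    k u t                         ∎
    where
    open ≡-Reasoning
    not-child : ¬ Bool.T (isChildOf u (newVertex t V))
    not-child p with isChildOf-sound u _ p
    ... | _ , eq = u≢V (sym (∷ʳ-injectiveˡ V u eq))

  record WellFormed (t : Tree) : Set where
    field
      unique  : Unique t
      label≤k : ∀ {u j w} → u ++ j ∷ w ∈ t → j ≤ k u t

    next-slot-empty : ∀ V {v} → v ∈ t → ∀ w → v ≢ V ++ suc (k V t) ∷ w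
    next-slot-empty V v∈t w refl = <-irrefl refl (label≤k v∈t)

  open WellFormed

  k-newVertex : ∀ {t} → WellFormed t → ∀ V → k (newVertex t V) (attach t V) ≡ 0
  k-newVertex {t} wf V = cong length (filter-none (T? ∘ isChildOf x) (All.tabulate not-child))
    where
    x = newVertex t V
    not-child : ∀ {v} → v ∈ attach t V → ¬ Bool.T (isChildOf x v)
    not-child {v} v∈ p with isChildOf-sound x v p | ∈-++⁻ t v∈
    ... | j , refl | inj₁ v∈t       = next-slot-empty wf V v∈t [ j ] (++-assoc V _ [ j ])
    ... | j , refl | inj₂ (here eq) = isChildOf-irrefl x (subst (Bool.T ∘ isChildOf x) eq p)

  attach-wellFormed : ∀ {t V} → WellFormed t → V ∈ t → WellFormed (attach t V)
  attach-wellFormed {t} {V} wf V∈t = record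
    { unique  = Unique.++⁺ (unique wf) ([] ∷ []) λ { (x∈t , here refl) → next-slot-empty wf V x∈t [] refl }
    ; label≤k = bounded
    }
    where
    grow : ∀ u {j} → j ≤ k u t → j ≤ k u (attach t V)
    grow u j≤ = ≤-trans j≤ (≤-trans (m≤m+n (k u t) _) (≤-reflexive (sym (k-++ u t _))))
    bounded : ∀ {u j w} → u ++ j ∷ w ∈ attach t V → j ≤ k u (attach t V)
    bounded {u} {j} {w} v∈ with ∈-++⁻ t v∈
    ... | inj₁ v∈t       = grow u (label≤k wf v∈t)
    ... | inj₂ (here eq) with decompose-∷ʳ u j w V _ eq
    ...   | inj₁ (refl , refl , refl) = ≤-reflexive (sym (k-attach-self t V))
    ...   | inj₂ (_ , refl)           = grow u (label≤k wf V∈t)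

  nextChildWeight : Tree → Word → ℕ
  nextChildWeight t v = weight v + suc (k v t)

  weight-newVertex : ∀ t V → weight (newVertex t V) ≡ nextChildWeight t V
  weight-newVertex t V = trans (sum-++ V _) (cong (weight V +_) (+-identityʳ _))

  nextChildWeight-attach-self : ∀ t V → nextChildWeight (attach t V) V ≡ suc (nextChildWeight t V)
  nextChildWeight-attach-self t V = trans (cong (λ c → weight V + suc c) (k-attach-self t V)) (+-suc (weight V) _)

  nextChildWeight-attach-other : ∀ t {u V} → u ≢ V → nextChildWeight (attach t V) u ≡ nextChildWeight t u
  nextChildWeight-attach-other t {u} u≢V = cong (λ c → weight u + suc c) (k-attach-other t u≢V)

  nextChildWeight-newVertex : ∀ {t} → WellFormed t → ∀ V →
    nextChildWeight (attach t V) (newVertex t V) ≡ suc (nextChildWeight t V)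
  nextChildWeight-newVertex {t} wf V = begin
    weight x + suc (k x (attach t V)) ≡⟨ cong (λ c → weight x + suc c) (k-newVertex wf V) ⟩
    weight x + 1                      ≡⟨ +-comm (weight x) 1 ⟩
    suc (weight x)                    ≡⟨ cong suc (weight-newVertex t V) ⟩
    suc (nextChildWeight t V)         ∎
    where
    open ≡-Reasoning
    x = newVertex t V

  heavySlots : ℕ → Tree → ℕ
  heavySlots j t = ∑[ v ← t ] 𝟙[ j ≤ nextChildWeight t v ]

  heavyPairs : ℕ → Tree → ℕ
  heavyPairs m t = ∑[ v ← t ] ∑[ v′ ← t ] 𝟙[ m ≤ weight (lcp v v′) ]

  heavySlots-zero : ∀ t → heavySlots 0 t ≡ length t
  heavySlots-zero t = trans (∑-const t 1) (*-identityʳ (length t))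

  heavySlots-attach : ∀ {t V} → WellFormed t → V ∈ t → ∀ j →
    heavySlots (suc j) (attach t V) + 𝟙[ suc j ≤ nextChildWeight t V ]
      ≡ heavySlots (suc j) t + 2 * 𝟙[ j ≤ nextChildWeight t V ]
  heavySlots-attach {t} {V} wf V∈t j = begin
    ∑ (attach t V) new + old V ≡⟨ cong (_+ old V) (∑-∷ʳ t x new) ⟩
    ∑ t new + new x + old V    ≡⟨ xy∙z≈xz∙y (∑ t new) (new x) (old V) ⟩
    ∑ t new + old V + new x    ≡⟨ cong (_+ new x) (∑-update new old (unique wf) V∈t unchanged) ⟩
    ∑ t old + new V + new x    ≡⟨ cong₂ (λ a c → ∑ t old + a + c) new-V new-x ⟩
    ∑ t old + b + b            ≡⟨ double (∑ t old) b ⟩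
    ∑ t old + 2 * b            ∎
    where
    open ≡-Reasoning
    x = newVertex t V
    b = 𝟙[ j ≤ nextChildWeight t V ]
    new old : Word → ℕ
    new v = 𝟙[ suc j ≤ nextChildWeight (attach t V) v ]
    old v = 𝟙[ suc j ≤ nextChildWeight t v ]
    unchanged : ∀ {v} → v ∈ t → v ≢ V → new v ≡ old v
    unchanged _ v≢V = cong 𝟙[ suc j ≤_] (nextChildWeight-attach-other t v≢V)
    new-V : new V ≡ b
    new-V = cong 𝟙[ suc j ≤_] (nextChildWeight-attach-self t V)
    new-x : new x ≡ b
    new-x = cong 𝟙[ suc j ≤_] (nextChildWeight-newVertex wf V)
    double : ∀ a b → a + b + b ≡ a + 2 * b
    double = solve-∀

  heavyPairs-attach : ∀ {t} → WellFormed t → ∀ V m →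
    heavyPairs m (attach t V)
      ≡ heavyPairs m t + 2 * ∑[ v ← t ] 𝟙[ m ≤ weight (lcp V v) ] + 𝟙[ m ≤ nextChildWeight t V ]
  heavyPairs-attach {t} wf V m = begin
    heavyPairs m (t ++ [ x ])
      ≡⟨ ∑∑-∷ʳ t x F (λ u v → cong (λ w → 𝟙[ m ≤ weight w ]) (lcp-comm u v)) ⟩
    heavyPairs m t + 2 * ∑[ v ← t ] F x v + F x x
      ≡⟨ cong₂ (λ r c → heavyPairs m t + 2 * r + c) (∑-cong t x-like-V) x-self ⟩
    heavyPairs m t + 2 * ∑[ v ← t ] F V v + 𝟙[ m ≤ nextChildWeight t V ] ∎
    where
    open ≡-Reasoning
    x = newVertex t V
    F : Word → Word → ℕ
    F u v = 𝟙[ m ≤ weight (lcp u v) ]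
    x-like-V : ∀ {v} → v ∈ t → F x v ≡ F V v
    x-like-V v∈t = cong (λ w → 𝟙[ m ≤ weight w ]) (lcp-∷ʳ V _ _ (next-slot-empty wf V v∈t))
    x-self : F x x ≡ 𝟙[ m ≤ nextChildWeight t V ]
    x-self = trans (cong (λ w → 𝟙[ m ≤ weight w ]) (lcp-self x)) (cong 𝟙[ m ≤_] (weight-newVertex t V))

  -- The potential

  -- For a tree with n vertices this is n times the conditional expectation of F(T_(n+1)) given T_n = t.
  extensionSum : (Tree → ℕ) → Tree → ℕ
  extensionSum F t = ∑[ V ← t ] F (attach t V)

  extensionSum-linear : ∀ a F b G t →
    extensionSum (λ s → a * F s + b * G s) t ≡ a * extensionSum F t + b * extensionSum G t
  extensionSum-linear a F b G t = trans (∑-+ t _ _) (cong₂ _+_ (∑-*ˡ t a _) (∑-*ˡ t b _))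

  extensionSum-length : ∀ t → extensionSum length t ≡ length t * suc (length t)
  extensionSum-length t = trans (∑-cong t (λ _ → trans (length-++ t) (+-comm (length t) 1))) (∑-const t _)

  extensionSum-heavySlots : ∀ {t} → WellFormed t → ∀ j →
    extensionSum (heavySlots (suc j)) t + heavySlots (suc j) t
      ≡ length t * heavySlots (suc j) t + 2 * heavySlots j t
  extensionSum-heavySlots {t} wf j = begin
    ∑[ V ← t ] heavySlots (suc j) (attach t V) + ∑[ V ← t ] 𝟙[ suc j ≤ nextChildWeight t V ]
      ≡⟨ ∑-+ t _ _ ⟨
    ∑[ V ← t ] (heavySlots (suc j) (attach t V) + 𝟙[ suc j ≤ nextChildWeight t V ])
      ≡⟨ ∑-cong t (λ V∈t → heavySlots-attach wf V∈t j) ⟩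
    ∑[ V ← t ] (heavySlots (suc j) t + 2 * 𝟙[ j ≤ nextChildWeight t V ])
      ≡⟨ ∑-+ t _ _ ⟩
    ∑[ V ← t ] heavySlots (suc j) t + ∑[ V ← t ] (2 * 𝟙[ j ≤ nextChildWeight t V ])
      ≡⟨ cong₂ _+_ (∑-const t _) (∑-*ˡ t 2 _) ⟩
    length t * heavySlots (suc j) t + 2 * heavySlots j t ∎
    where open ≡-Reasoning

  extensionSum-heavyPairs : ∀ {t} → WellFormed t → ∀ m →
    extensionSum (heavyPairs m) t ≡ (length t + 2) * heavyPairs m t + heavySlots m t
  extensionSum-heavyPairs {t} wf m = begin
    ∑[ V ← t ] heavyPairs m (attach t V)
      ≡⟨ ∑-cong t (λ {V} _ → heavyPairs-attach wf V m) ⟩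
    ∑[ V ← t ] (heavyPairs m t + 2 * R V + 𝟙[ m ≤ nextChildWeight t V ])
      ≡⟨ trans (∑-+ t _ _) (cong (_+ heavySlots m t) (∑-+ t _ _)) ⟩
    ∑[ V ← t ] heavyPairs m t + ∑[ V ← t ] (2 * R V) + heavySlots m t
      ≡⟨ cong (_+ heavySlots m t) (cong₂ _+_ (∑-const t _) (∑-*ˡ t 2 R)) ⟩
    length t * heavyPairs m t + 2 * heavyPairs m t + heavySlots m t
      ≡⟨ cong (_+ heavySlots m t) (*-distribʳ-+ (heavyPairs m t) (length t) 2) ⟨
    (length t + 2) * heavyPairs m t + heavySlots m t ∎
    where
    open ≡-Reasoning
    R : Word → ℕ
    R V = ∑[ v ← t ] 𝟙[ m ≤ weight (lcp V v) ]

  slotPotential : ℕ → Tree → ℕ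
  slotPotential zero    t = length t
  slotPotential (suc j) t = 3 ^ j * heavySlots (suc j) t + 2 * slotPotential j t

  potential : ℕ → Tree → ℕ
  potential j t = 3 ^ suc j * heavyPairs (suc j) t + slotPotential (suc j) t

  private
    combination-+ : ∀ a b x x′ y y′ → (a * x + b * y) + (a * x′ + b * y′) ≡ a * (x + x′) + b * (y + y′)
    combination-+ = solve-∀

  extensionSum-slotPotential : ∀ {t} → WellFormed t → ∀ j →
    extensionSum (slotPotential (suc j)) t + slotPotential (suc j) t
      ≡ length t * slotPotential (suc j) t + 6 * slotPotential j t
  extensionSum-slotPotential {t} wf zero = begin
    extensionSum (slotPotential 1) t + slotPotential 1 t
      ≡⟨ cong (_+ slotPotential 1 t) (extensionSum-linear 1 (heavySlots 1) 2 length t) ⟩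
    (1 * extensionSum G t + 2 * extensionSum length t) + (1 * G t + 2 * n)
      ≡⟨ combination-+ 1 2 (extensionSum G t) (G t) (extensionSum length t) n ⟩
    1 * (extensionSum G t + G t) + 2 * (extensionSum length t + n)
      ≡⟨ cong₂ (λ g l → 1 * g + 2 * (l + n)) (extensionSum-heavySlots wf 0) (extensionSum-length t) ⟩
    1 * (n * G t + 2 * heavySlots 0 t) + 2 * (n * suc n + n)
      ≡⟨ cong (λ g → 1 * (n * G t + 2 * g) + 2 * (n * suc n + n)) (heavySlots-zero t) ⟩
    1 * (n * G t + 2 * n) + 2 * (n * suc n + n)
      ≡⟨ regroup n (G t) ⟩
    n * slotPotential 1 t + 6 * n ∎
    where
    open ≡-Reasoning
    n = length t
    G = heavySlots 1
    regroup : ∀ n g → 1 * (n * g + 2 * n) + 2 * (n * suc n + n) ≡ n * (1 * g + 2 * n) + 6 * n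
    regroup = solve-∀
  extensionSum-slotPotential {t} wf (suc j) = begin
    extensionSum (slotPotential (2 + j)) t + slotPotential (2 + j) t
      ≡⟨ cong (_+ slotPotential (2 + j) t) (extensionSum-linear (3 ^ suc j) G 2 S t) ⟩
    (3 ^ suc j * extensionSum G t + 2 * extensionSum S t) + (3 ^ suc j * G t + 2 * S t)
      ≡⟨ combination-+ (3 ^ suc j) 2 (extensionSum G t) (G t) (extensionSum S t) (S t) ⟩
    3 ^ suc j * (extensionSum G t + G t) + 2 * (extensionSum S t + S t)
      ≡⟨ cong₂ (λ g s → 3 ^ suc j * g + 2 * s) (extensionSum-heavySlots wf (suc j)) (extensionSum-slotPotential wf j) ⟩
    3 ^ suc j * (n * G t + 2 * heavySlots (suc j) t) + 2 * (n * S t + 6 * slotPotential j t)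
      ≡⟨ regroup n (3 ^ j) (G t) (heavySlots (suc j) t) (slotPotential j t) ⟩
    n * slotPotential (2 + j) t + 6 * slotPotential (suc j) t ∎
    where
    open ≡-Reasoning
    n = length t
    G = heavySlots (2 + j)
    S = slotPotential (suc j)
    regroup : ∀ n p g g′ s′ →
      3 * p * (n * g + 2 * g′) + 2 * (n * (p * g′ + 2 * s′) + 6 * s′)
        ≡ n * (3 * p * g + 2 * (p * g′ + 2 * s′)) + 6 * (p * g′ + 2 * s′)
    regroup = solve-∀

  extensionSum-potential : ∀ {t} → WellFormed t → ∀ j →
    extensionSum (potential j) t ≡ (length t + 2) * potential j t
  extensionSum-potential {t} wf j = +-cancelʳ-≡ (S t) _ _ (begin
    extensionSum (potential j) t + S t
      ≡⟨ cong (_+ S t) (trans (∑-+ t _ _) (cong (_+ extensionSum S t) (∑-*ˡ t (3 ^ suc j) _))) ⟩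
    3 ^ suc j * extensionSum Q t + extensionSum S t + S t
      ≡⟨ +-assoc (3 ^ suc j * extensionSum Q t) _ _ ⟩
    3 ^ suc j * extensionSum Q t + (extensionSum S t + S t)
      ≡⟨ cong₂ (λ q s → 3 ^ suc j * q + s) (extensionSum-heavyPairs wf (suc j)) (extensionSum-slotPotential wf j) ⟩
    3 ^ suc j * ((n + 2) * Q t + heavySlots (suc j) t) + (n * S t + 6 * slotPotential j t)
      ≡⟨ regroup n (3 ^ j) (Q t) (heavySlots (suc j) t) (slotPotential j t) ⟩
    (n + 2) * potential j t + S t ∎)
    where
    open ≡-Reasoning
    n = length t
    Q = heavyPairs (suc j)
    S = slotPotential (suc j)
    regroup : ∀ n p q g s′ →
      3 * p * ((n + 2) * q + g) + (n * (p * g + 2 * s′) + 6 * s′)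
        ≡ (n + 2) * (3 * p * q + (p * g + 2 * s′)) + (p * g + 2 * s′)
    regroup = solve-∀

  potential-root : ∀ j → potential j [ [] ] ≡ 3 * 2 ^ j
  potential-root j = trans (cong (_+ slotPotential (suc j) [ [] ]) (*-zeroʳ (3 ^ suc j))) (slotPotential-root j)
    where
    slotPotential-root : ∀ j → slotPotential (suc j) [ [] ] ≡ 3 * 2 ^ j
    slotPotential-root zero    = refl
    slotPotential-root (suc j) = begin
      3 ^ suc j * 0 + 2 * slotPotential (suc j) [ [] ] ≡⟨ cong₂ (λ a b → a + 2 * b) (*-zeroʳ (3 ^ suc j)) (slotPotential-root j) ⟩
      2 * (3 * 2 ^ j)                                   ≡⟨ x∙yz≈y∙xz 2 3 (2 ^ j) ⟩
      3 * (2 * 2 ^ j)                                   ∎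
      where open ≡-Reasoning

  -- Summing over all histories

  histories : ∀ n → List (Hist n)
  histories zero          = []
  histories (suc zero)    = [ start ]
  histories (suc (suc n)) = concatMap (λ h → tabulate (step h)) (histories (suc n))

  ∈-histories : ∀ {n} (h : Hist n) → h ∈ histories n
  ∈-histories start                    = here refl
  ∈-histories {suc zero}    (step () _)
  ∈-histories {suc (suc n)} (step h c) =
    ∈-concatMap⁺ (λ h → tabulate (step h)) (Any.map (λ { refl → ∈-tabulate⁺ {f = step h} c }) (∈-histories h))

  T-step : ∀ {n} (h : Hist n) c → T (step h c) ≡ attach (T h) (lookup (tree h) c)
  T-step h c = toList-∷ʳ _ (tree h)

  length-T : ∀ {n} (h : Hist n) → length (T h) ≡ n
  length-T h = length-toList (tree h)

  wellFormed-T : ∀ {n} (h : Hist n) → WellFormed (T h)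
  wellFormed-T start = record
    { unique  = [] ∷ []
    ; label≤k = λ { {u} (here eq) → contradiction (++-conicalʳ u _ eq) λ () }
    }
  wellFormed-T (step h c) =
    subst WellFormed (sym (T-step h c)) (attach-wellFormed (wellFormed-T h) (∈-toList⁺ (∈-lookup c (tree h))))

  tabulate-∘lookup : ∀ {A B : Set} {n} (f : A → B) (v : Vec A n) → tabulate (f ∘ lookup v) ≡ map f (toList v)
  tabulate-∘lookup f Vec.[]       = refl
  tabulate-∘lookup f (x Vec.∷ v) = cong (f x ∷_) (tabulate-∘lookup f v)

  ∑-histories-suc : ∀ n F →
    ∑[ h ← histories (suc (suc n)) ] F (T h) ≡ ∑[ h ← histories (suc n) ] extensionSum F (T h)
  ∑-histories-suc n F =
    trans (∑-concatMap (λ h → tabulate (step h)) (histories (suc n)) (F ∘ T)) (∑-cong (histories (suc n)) (λ {h} _ → children h))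
    where
    children : ∀ {m} (h : Hist m) → ∑ (tabulate (step h)) (F ∘ T) ≡ extensionSum F (T h)
    children h = cong sum (trans (map-tabulate (step h) (F ∘ T))
                                 (trans (tabulate-cong (cong F ∘ T-step h)) (tabulate-∘lookup (F ∘ attach (T h)) (tree h))))

  ∑-histories-eigenfunction : ∀ (F : Tree → ℕ) → (∀ {t} → WellFormed t → extensionSum F t ≡ (length t + 2) * F t) →
    ∀ n → 2 * ∑[ h ← histories (suc n) ] F (T h) ≡ (2 + n) ! * F [ [] ]
  ∑-histories-eigenfunction F eigen zero    = cong (2 *_) (+-identityʳ (F [ [] ]))
  ∑-histories-eigenfunction F eigen (suc n) = begin
    2 * ∑[ h ← histories (2 + n) ] F (T h)              ≡⟨ cong (2 *_) (∑-histories-suc n F) ⟩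
    2 * ∑[ h ← hs ] extensionSum F (T h)                ≡⟨ cong (2 *_) (∑-cong hs (λ {h} _ → scale h)) ⟩
    2 * ∑[ h ← hs ] ((3 + n) * F (T h))                 ≡⟨ cong (2 *_) (∑-*ˡ hs (3 + n) _) ⟩
    2 * ((3 + n) * ∑[ h ← hs ] F (T h))                 ≡⟨ x∙yz≈y∙xz 2 (3 + n) (∑[ h ← hs ] F (T h)) ⟩
    (3 + n) * (2 * ∑[ h ← hs ] F (T h))                 ≡⟨ cong ((3 + n) *_) (∑-histories-eigenfunction F eigen n) ⟩
    (3 + n) * ((2 + n) ! * F [ [] ])                    ≡⟨ *-assoc (3 + n) ((2 + n) !) (F [ [] ]) ⟨
    (3 + n) ! * F [ [] ]                                ∎
    where
    open ≡-Reasoning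
    hs = histories (suc n)
    scale : (h : Hist (suc n)) → extensionSum F (T h) ≡ (3 + n) * F (T h)
    scale h = trans (eigen (wellFormed-T h)) (cong (_* F (T h)) (trans (cong (_+ 2) (length-T h)) (+-comm (suc n) 2)))

  ∑-histories-heavyPairs≤ : ∀ n j →
    3 ^ j * ∑[ h ← histories (suc n) ] heavyPairs (suc j) (T h) ≤ 2 ^ j * (suc n * suc n * n !)
  ∑-histories-heavyPairs≤ n j = *-cancelˡ-≤ 2 (*-cancelˡ-≤ 3 (begin
    3 * (2 * (3 ^ j * S))                    ≡⟨ shuffle (3 ^ j) S ⟩
    2 * (3 ^ suc j * S)                      ≤⟨ *-monoʳ-≤ 2 S≤Φ ⟩
    2 * ∑[ h ← hs ] potential j (T h)        ≡⟨ ∑-histories-eigenfunction (potential j) (λ wf → extensionSum-potential wf j) n ⟩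
    (2 + n) ! * potential j [ [] ]           ≡⟨ cong ((2 + n) ! *_) (potential-root j) ⟩
    (2 + n) ! * (3 * 2 ^ j)                  ≤⟨ *-monoˡ-≤ (3 * 2 ^ j) fact≤ ⟩
    2 * (suc n * suc n * n !) * (3 * 2 ^ j)  ≡⟨ shuffle′ (suc n * suc n * n !) (2 ^ j) ⟩
    3 * (2 * (2 ^ j * (suc n * suc n * n !))) ∎))
    where
    open ≤-Reasoning
    hs = histories (suc n)
    S = ∑[ h ← hs ] heavyPairs (suc j) (T h)
    S≤Φ : 3 ^ suc j * S ≤ ∑[ h ← hs ] potential j (T h)
    S≤Φ = ≤-trans (≤-reflexive (sym (∑-*ˡ hs (3 ^ suc j) _))) (∑-mono hs (λ _ → m≤m+n _ _))
    fact≤ : (2 + n) ! ≤ 2 * (suc n * suc n * n !)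
    fact≤ = ≤-trans (*-monoˡ-≤ (suc n * n !) (s≤s (m≤n+m (suc n) n))) (≤-reflexive (regroup n (n !)))
      where
      regroup : ∀ n f → (suc n + suc n) * (suc n * f) ≡ 2 * (suc n * suc n * f)
      regroup = solve-∀
    shuffle : ∀ p s → 3 * (2 * (p * s)) ≡ 2 * (3 * p * s)
    shuffle = solve-∀
    shuffle′ : ∀ a p → 2 * a * (3 * p) ≡ 3 * (2 * (p * a))
    shuffle′ = solve-∀

  -- Descendants

  length-θ-≤ : ∀ u t → length (θ u t) ≤ length (filterᵇ (isPrefix u) t)
  length-θ-≤ u t with memb u t
  ... | true  = ≤-reflexive (length-map (drop (length u)) (filterᵇ (isPrefix u) t))
  ... | false = z≤n

  descendants²≤heavyPairs : ∀ {t} → Unique t → ∀ {m} u → m ≤ weight u →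
    let D = filterᵇ (isPrefix u) t in length D * length D ≤ heavyPairs m t
  descendants²≤heavyPairs {t} uniq {m} u m≤wu = begin
    length D * length D             ≡⟨ cong (length D *_) (*-identityʳ (length D)) ⟨
    length D * (length D * 1)       ≡⟨ trans (∑-const D _) (cong (length D *_) (∑-const D 1)) ⟨
    ∑[ v ← D ] ∑[ v′ ← D ] 1        ≤⟨ ∑-mono D (λ v∈D → ∑-mono D (λ v′∈D → ≤-reflexive (sym (share-u v∈D v′∈D)))) ⟩
    ∑[ v ← D ] ∑[ v′ ← D ] F v v′   ≤⟨ ∑-mono D (λ _ → ∑-mono-⊆ _ uniq-D D⊆t) ⟩
    ∑[ v ← D ] ∑[ v′ ← t ] F v v′   ≤⟨ ∑-mono-⊆ _ uniq-D D⊆t ⟩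
    heavyPairs m t                  ∎
    where
    open ≤-Reasoning
    D = filterᵇ (isPrefix u) t
    F : Word → Word → ℕ
    F v v′ = 𝟙[ m ≤ weight (lcp v v′) ]
    uniq-D : Unique D
    uniq-D = Unique.filter⁺ (T? ∘ isPrefix u) uniq
    D-member : ∀ {v} → v ∈ D → v ∈ t × Bool.T (isPrefix u v)
    D-member = ∈-filter⁻ (T? ∘ isPrefix u) {xs = t}
    D⊆t : ∀ {v} → v ∈ D → v ∈ t
    D⊆t = proj₁ ∘ D-member
    share-u : ∀ {v v′} → v ∈ D → v′ ∈ D → F v v′ ≡ 1
    share-u {v} {v′} v∈D v′∈D
      with isPrefix-sound u v (proj₂ (D-member v∈D)) | isPrefix-sound u v′ (proj₂ (D-member v′∈D))
    ... | w , refl | w′ , refl = 𝟙[≤]-true (begin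
      m                         ≤⟨ m≤wu ⟩
      weight u                  ≤⟨ weight-++-≤ˡ u (lcp w w′) ⟩
      weight (u ++ lcp w w′)    ≡⟨ cong weight (lcp-++ u w w′) ⟨
      weight (lcp (u ++ w) (u ++ w′)) ∎)

  θ²≤heavyPairs : ∀ {t} → Unique t → ∀ {m} u → m ≤ weight u → length (θ u t) * length (θ u t) ≤ heavyPairs m t
  θ²≤heavyPairs {t} uniq u m≤wu =
    ≤-trans (*-mono-≤ (length-θ-≤ u t) (length-θ-≤ u t)) (descendants²≤heavyPairs uniq u m≤wu)

module RationalBounds where

  open ListSums using (∑)
  open import Data.Nat as ℕ using (ℕ; zero; suc; _^_)
  import Data.Nat.Properties as ℕ
  open import Data.Nat.Coprimality using (1-coprimeTo) renaming (sym to coprime-sym)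
  open import Data.Integer as ℤ using (+_)
  import Data.Integer.Properties as ℤ
  open import Data.Rational using (ℚ; mkℚ; _/_; _*_; _+_; _≤_; *≤*; 1/_; 1ℚ; Positive; NonNegative; NonZero; toℚᵘ)
  open import Data.Rational.Properties
  open import Data.Rational.Unnormalised as ℚᵘ using (mkℚᵘ; *≡*)
  import Data.Rational.Unnormalised.Properties as ℚᵘ
  open import Data.Rational.Solver using (module +-*-Solver)

  fromℕ : ℕ → ℚ
  fromℕ n = + n / 1

  -- `+ n / 1` is defined by gcd normalisation, which does not compute for a variable n.
  fromℕ-normal : ∀ n → fromℕ n ≡ mkℚ (+ n) 0 (coprime-sym (1-coprimeTo n))
  fromℕ-normal n = normalize-coprime (coprime-sym (1-coprimeTo n))

  fromℕ-+ : ∀ m n → fromℕ (m ℕ.+ n) ≡ fromℕ m + fromℕ n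
  fromℕ-+ m n rewrite fromℕ-normal m | fromℕ-normal n =
    cong (_/ 1) (sym (cong₂ ℤ._+_ (ℤ.*-identityʳ (+ m)) (ℤ.*-identityʳ (+ n))))

  fromℕ-* : ∀ m n → fromℕ (m ℕ.* n) ≡ fromℕ m * fromℕ n
  fromℕ-* m n rewrite fromℕ-normal m | fromℕ-normal n = cong (_/ 1) (ℤ.pos-* m n)

  fromℕ-mono-≤ : ∀ {m n} → m ℕ.≤ n → fromℕ m ≤ fromℕ n
  fromℕ-mono-≤ {m} {n} m≤n rewrite fromℕ-normal m | fromℕ-normal n =
    *≤* (subst₂ ℤ._≤_ (sym (ℤ.*-identityʳ (+ m))) (sym (ℤ.*-identityʳ (+ n))) (ℤ.+≤+ m≤n))

  fromℕ-nonNeg : ∀ n → NonNegative (fromℕ n)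
  fromℕ-nonNeg n = normalize-nonNeg n 1

  fromℕ-pos : ∀ n .{{_ : ℕ.NonZero n}} → Positive (fromℕ n)
  fromℕ-pos n = normalize-pos n 1

  /-*-inverse : ∀ m d .{{_ : ℕ.NonZero d}} → (+ m / d) * fromℕ d ≡ fromℕ m
  /-*-inverse m (suc d) = toℚᵘ-injective (begin
    toℚᵘ ((+ m / suc d) * fromℕ (suc d))          ≈⟨ toℚᵘ-homo-* (+ m / suc d) (fromℕ (suc d)) ⟩
    toℚᵘ (+ m / suc d) ℚᵘ.* toℚᵘ (fromℕ (suc d))  ≈⟨ ℚᵘ.*-cong (toℚᵘ-fromℚᵘ (mkℚᵘ (+ m) d)) (toℚᵘ-fromℚᵘ (mkℚᵘ (+ suc d) 0)) ⟩
    mkℚᵘ (+ m) d ℚᵘ.* mkℚᵘ (+ suc d) 0             ≈⟨ *≡* cross ⟩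
    mkℚᵘ (+ m) 0                                   ≈⟨ toℚᵘ-fromℚᵘ (mkℚᵘ (+ m) 0) ⟨
    toℚᵘ (fromℕ m)                                 ∎)
    where
    open ℚᵘ.≃-Reasoning
    cross : (+ m ℤ.* + suc d) ℤ.* + 1 ≡ + m ℤ.* + (suc d ℕ.* 1)
    cross = trans (ℤ.*-identityʳ _) (cong (λ e → + m ℤ.* + e) (sym (ℕ.*-identityʳ (suc d))))

  powℚ-2/3 : ∀ j → powℚ (+ 2 / 3) j * fromℕ (3 ^ j) ≡ fromℕ (2 ^ j)
  powℚ-2/3 zero    = *-identityˡ (fromℕ 1)
  powℚ-2/3 (suc j) = begin
    (+ 2 / 3 * P) * fromℕ (3 ℕ.* 3 ^ j)          ≡⟨ cong (+ 2 / 3 * P *_) (fromℕ-* 3 (3 ^ j)) ⟩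
    (+ 2 / 3 * P) * (fromℕ 3 * fromℕ (3 ^ j))    ≡⟨ solve 4 (λ a b c d → a :* b :* (c :* d) := a :* c :* (b :* d))
                                                          refl (+ 2 / 3) P (fromℕ 3) (fromℕ (3 ^ j)) ⟩
    (+ 2 / 3 * fromℕ 3) * (P * fromℕ (3 ^ j))    ≡⟨ cong (fromℕ 2 *_) (powℚ-2/3 j) ⟩
    fromℕ 2 * fromℕ (2 ^ j)                       ≡⟨ fromℕ-* 2 (2 ^ j) ⟨
    fromℕ (2 ℕ.* 2 ^ j)                           ∎
    where
    open ≡-Reasoning
    open +-*-Solver
    P = powℚ (+ 2 / 3) j

  length*≤∑ : ∀ {A : Set} (xs : List A) f {c} → All (λ x → c ≤ fromℕ (f x)) xs → fromℕ (length xs) * c ≤ fromℕ (∑ xs f)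
  length*≤∑ []       f {c} []         = ≤-reflexive (*-zeroˡ c)
  length*≤∑ (x ∷ xs) f {c} (c≤ ∷ c≤s) = begin
    fromℕ (suc (length xs)) * c          ≡⟨ cong (_* c) (fromℕ-+ 1 (length xs)) ⟩
    (fromℕ 1 + fromℕ (length xs)) * c    ≡⟨ *-distribʳ-+ c (fromℕ 1) (fromℕ (length xs)) ⟩
    fromℕ 1 * c + fromℕ (length xs) * c  ≡⟨ cong (_+ fromℕ (length xs) * c) (*-identityˡ c) ⟩
    c + fromℕ (length xs) * c            ≤⟨ +-mono-≤ c≤ (length*≤∑ xs f c≤s) ⟩
    fromℕ (f x) + fromℕ (∑ xs f)         ≡⟨ fromℕ-+ (f x) (∑ xs f) ⟨
    fromℕ (f x ℕ.+ ∑ xs f)               ∎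
    where open ≤-Reasoning

  ratio≤bound : ∀ (ε : ℚ) .{{_ : Positive ε}} x q j N D .{{_ : ℕ.NonZero N}} .{{_ : ℕ.NonZero D}} →
    fromℕ x * ((ε * fromℕ N) * (ε * fromℕ N)) ≤ fromℕ q →
    3 ^ j ℕ.* q ℕ.≤ 2 ^ j ℕ.* (N ℕ.* N ℕ.* D) →
    + x / D ≤ bound (suc j) ε
  ratio≤bound ε x q j N D xc≤q 3ʲq≤2ʲK = begin
    r              ≡⟨ cancel-E ⟨
    1/E * (r * E)  ≤⟨ *-monoˡ-≤-nonNeg 1/E {{pos⇒nonNeg 1/E {{1/pos⇒pos E}}}} rE≤P ⟩
    1/E * P        ∎
    where
    open ≤-Reasoning
    open +-*-Solver
    r = + x / D
    E = ε * ε
    P = powℚ (+ 2 / 3) j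
    K = fromℕ (N ℕ.* N ℕ.* D)
    instance
      E-pos : Positive E
      E-pos = pos*pos⇒pos ε ε
      E-nonZero : NonZero E
      E-nonZero = pos⇒nonZero E
    1/E = 1/ E
    cancel-E : 1/E * (r * E) ≡ r
    cancel-E = begin-equality
      1/E * (r * E)  ≡⟨ solve 3 (λ a b c → a :* (b :* c) := b :* (c :* a)) refl 1/E r E ⟩
      r * (E * 1/E)  ≡⟨ cong (r *_) (*-inverseʳ E) ⟩
      r * 1ℚ         ≡⟨ *-identityʳ r ⟩
      r              ∎
    K-split : K ≡ fromℕ N * fromℕ N * fromℕ D
    K-split = trans (fromℕ-* (N ℕ.* N) D) (cong (_* fromℕ D) (fromℕ-* N N))
    q≤PK : fromℕ q ≤ P * K
    q≤PK = *-cancelˡ-≤-pos (fromℕ (3 ^ j)) {{fromℕ-pos (3 ^ j) {{ℕ.m^n≢0 3 j}}}} (begin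
      fromℕ (3 ^ j) * fromℕ q            ≡⟨ fromℕ-* (3 ^ j) q ⟨
      fromℕ (3 ^ j ℕ.* q)                ≤⟨ fromℕ-mono-≤ 3ʲq≤2ʲK ⟩
      fromℕ (2 ^ j ℕ.* (N ℕ.* N ℕ.* D))  ≡⟨ fromℕ-* (2 ^ j) _ ⟩
      fromℕ (2 ^ j) * K                  ≡⟨ cong (_* K) (powℚ-2/3 j) ⟨
      P * fromℕ (3 ^ j) * K              ≡⟨ solve 3 (λ a b c → a :* b :* c := b :* (a :* c)) refl P (fromℕ (3 ^ j)) K ⟩
      fromℕ (3 ^ j) * (P * K)            ∎)
    rE≤P : r * E ≤ P
    rE≤P = *-cancelʳ-≤-pos K {{fromℕ-pos (N ℕ.* N ℕ.* D) {{ℕ.m*n≢0 (N ℕ.* N) D {{ℕ.m*n≢0 N N}}}}}} (begin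
      r * E * K                                      ≡⟨ cong (r * E *_) K-split ⟩
      r * E * (fromℕ N * fromℕ N * fromℕ D)
        ≡⟨ solve 4 (λ r e n d → r :* (e :* e) :* (n :* n :* d) := r :* d :* (e :* n :* (e :* n))) refl r ε (fromℕ N) (fromℕ D) ⟩
      r * fromℕ D * ((ε * fromℕ N) * (ε * fromℕ N))  ≡⟨ cong (_* ((ε * fromℕ N) * (ε * fromℕ N))) (/-*-inverse x D) ⟩
      fromℕ x * ((ε * fromℕ N) * (ε * fromℕ N))      ≤⟨ xc≤q ⟩
      fromℕ q                                        ≤⟨ q≤PK ⟩
      P * K                                          ∎)

open import Data.Nat using (ℕ; suc; _≤_)
open import Data.Rational using (ℚ; Positive; 1ℚ; _+_) renaming (_≤_ to _≤ℚ_; _<_ to _<ℚ_)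
open import Data.List using (List; length)
open import Data.List.Relation.Unary.All using (All)
open import Data.List.Relation.Unary.Unique.Propositional using (Unique)
open import Data.Product using (∃-syntax)
import Data.Nat as ℕ
open import Data.Nat using (_!)
open import Data.Nat.Properties using (_!≢0)
open import Data.Rational using (_*_; NonNegative)
open import Data.Rational.Properties
  using (module ≤-Reasoning; ≤-trans; ≤-reflexive; +-monoʳ-≤; +-identityʳ; *-monoʳ-≤-nonNeg; *-monoˡ-≤-nonNeg;
         nonNeg*nonNeg⇒nonNeg; pos⇒nonNeg; nonNegative⁻¹)
open ListSums using (∑; ∑-mono-⊆)
open PlaneTrees using (heavyPairs; histories; ∈-histories; wellFormed-T; θ²≤heavyPairs; ∑-histories-heavyPairs≤; module WellFormed)
open RationalBounds using (fromℕ; fromℕ-*; fromℕ-mono-≤; fromℕ-nonNeg; length*≤∑; ratio≤bound)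

event⇒heavyPairs : ∀ {m ε n} .{{_ : Positive ε}} (h : Hist (suc n)) → Event m ε h →
  (ε * fromℕ (suc n)) * (ε * fromℕ (suc n)) ≤ℚ fromℕ (heavyPairs m (T h))
event⇒heavyPairs {m} {ε} {n} h (u , m≤wu , εn≤ℓ) = begin
  εn * εn                     ≤⟨ *-monoʳ-≤-nonNeg εn {{εn-nonNeg}} εn≤ℓ ⟩
  fromℕ ℓ * εn                ≤⟨ *-monoˡ-≤-nonNeg (fromℕ ℓ) {{fromℕ-nonNeg ℓ}} εn≤ℓ ⟩
  fromℕ ℓ * fromℕ ℓ           ≡⟨ fromℕ-* ℓ ℓ ⟨
  fromℕ (ℓ ℕ.* ℓ)             ≤⟨ fromℕ-mono-≤ (θ²≤heavyPairs (WellFormed.unique (wellFormed-T h)) u m≤wu) ⟩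
  fromℕ (heavyPairs m (T h))  ∎
  where
  open ≤-Reasoning
  εn = ε * fromℕ (suc n)
  εn-nonNeg : NonNegative εn
  εn-nonNeg = nonNeg*nonNeg⇒nonNeg ε {{pos⇒nonNeg ε}} (fromℕ (suc n)) {{fromℕ-nonNeg (suc n)}}
  ℓ = length (θ u (T h))

lemma4p2 : (m : ℕ) → 1 ≤ m → (ε : ℚ) → .{{_ : Positive ε}} → ε <ℚ 1ℚ →
  (δ : ℚ) → .{{_ : Positive δ}} →
  ∃[ N ] ((n : ℕ) → N ≤ n →
    (L : List (Hist (suc n))) → Unique L → All (Event m ε) L →
    (length L /! n) ≤ℚ (bound m ε + δ))
lemma4p2 (suc j) _ ε _ δ = 0 , λ n _ L uniq events →
  ≤-trans (ratio≤bound ε (length L) (S n) j (suc n) (n !) {{_}} {{n !≢0}} (weighted n L uniq events) (∑-histories-heavyPairs≤ n j))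
          (≤+δ (bound (suc j) ε))
  where
  S : ℕ → ℕ
  S n = ∑[ h ← histories (suc n) ] heavyPairs (suc j) (T h)
  weighted : ∀ n (L : List (Hist (suc n))) → Unique L → All (Event (suc j) ε) L →
    fromℕ (length L) * ((ε * fromℕ (suc n)) * (ε * fromℕ (suc n))) ≤ℚ fromℕ (S n)
  weighted n L uniq events =
    ≤-trans (length*≤∑ L _ (All.map (λ {h} → event⇒heavyPairs {suc j} {ε} {n} h) events))
            (fromℕ-mono-≤ (∑-mono-⊆ _ uniq (λ {h} _ → ∈-histories h)))
  ≤+δ : ∀ p → p ≤ℚ p + δ
  ≤+δ p = ≤-trans (≤-reflexive (sym (+-identityʳ p))) (+-monoʳ-≤ p (nonNegative⁻¹ δ {{pos⇒nonNeg δ}}))
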